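{- There does not exist a finite digraph that is simultaneously irreflexive, improper, and homomorphism-homogeneous.
   Context: A digraph $D=(V,E)$ (binary relational system, $E\subseteq V^2$) is irreflexive if $(x,x)\notin E$ for all $x\in V$; symmetric if $(x,y)\in E$ implies $(y,x)\in E$; antisymmetric if $(x,y)\in E$ implies $(y,x)\notin E$ for distinct $x,y$. $D$ is improper if $E$ is neither symmetric nor antisymmetric. A homomorphism $f:D_1\to D_2$ is a vertex map with $(x,y)\in E_1\Rightarrow (f(x),f(y))\in E_2$; an endomorphism is a homomorphism $D\to D$. For $\emptyset\neq W\subseteq V$, $D[W]=(W,E\cap W^2)$. $D$ is homomorphism-homogeneous if every homomorphism between finite induced subdigraphs of $D$ extends to an endomorphism of $D$. -}

module Defs where

open import Data.Nat using (ℕ)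
open import Data.Fin using (Fin)
open import Data.Fin.Subset using (Subset; _∈_; Nonempty)
open import Data.Bool using (Bool; T)
open import Data.Product using (Σ; ∃; _×_; _,_; proj₁)
open import Data.Empty using (⊥)
open import Relation.Nullary using (¬_)
open import Relation.Binary.PropositionalEquality using (_≡_)

record Digraph (n : ℕ) : Set where
  constructor digraph
  field
    adj : Fin n → Fin n → Bool

open Digraph public

Edge : ∀ {n} → Digraph n → Fin n → Fin n → Set
Edge D x y = T (adj D x y)

Irreflexive : ∀ {n} → Digraph n → Set
Irreflexive D = ∀ x → ¬ Edge D x x

Symmetric : ∀ {n} → Digraph n → Set
Symmetric D = ∀ x y → Edge D x y → Edge D y x

Antisymmetric : ∀ {n} → Digraph n → Set
Antisymmetric D = ∀ x y → ¬ (x ≡ y) → Edge D x y → ¬ Edge D y x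

Improper : ∀ {n} → Digraph n → Set
Improper D = ¬ Symmetric D × ¬ Antisymmetric D

Elem : ∀ {n} → Subset n → Set
Elem {n} W = Σ (Fin n) (λ x → x ∈ W)

-- homomorphism D[A] → D[B] (edges of D[W] are the edges of D between members of W)
IsInducedHom : ∀ {n} (D : Digraph n) (A B : Subset n) → (Elem A → Elem B) → Set
IsInducedHom D A B f =
  ∀ (x y : Elem A) → Edge D (proj₁ x) (proj₁ y) → Edge D (proj₁ (f x)) (proj₁ (f y))

IsEndo : ∀ {n} (D : Digraph n) → (Fin n → Fin n) → Set
IsEndo D g = ∀ x y → Edge D x y → Edge D (g x) (g y)

HomomorphismHomogeneous : ∀ {n} → Digraph n → Set
HomomorphismHomogeneous {n} D =
  ∀ (A B : Subset n) → Nonempty A → Nonempty B →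
  (f : Elem A → Elem B) → IsInducedHom D A B f →
  Σ (Fin n → Fin n) λ g → IsEndo D g × (∀ (x : Elem A) → g (proj₁ x) ≡ proj₁ (f x))

-- An irreflexive homomorphism-homogeneous digraph with a 2-cycle and a one-way
-- edge contains symmetric cliques of every size, impossible when it is finite.
-- If K is a symmetric clique and u differs from every K i with i ≢ j, sending u
-- to K j and fixing the other K i is a homomorphism of induced subdigraphs, so it
-- extends to an endomorphism g; then g (K j) is joined both ways to each K i with
-- i ≢ j and relates to K j as u does. For a one-way edge a → b, move K so that
-- K 0 = b (maps of singletons extend) and apply this to u = a: this gives v with
-- K i → v for all i and v → K i for i ≢ 0. Applying it again to u = v and j = 1
-- yields a vertex joined both ways to all of K.
module Submission where

open import Defs
open import Data.Nat using (ℕ; zero; suc; _<_; _+_; z<s)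
open import Data.Nat.Properties using (m<n+m)
open import Data.Fin using (Fin; zero; suc; _≟_)
open import Data.Fin.Properties using (all?; any?; ¬∀⟶∃¬; pigeonhole; <⇒≢)
open import Data.Fin.Subset using (Subset; _∈_; ⊤; ⁅_⁆)
open import Data.Fin.Subset.Properties using (∈⊤; x∈⁅x⁆; x∈⁅y⁆⇒x≡y)
open import Data.Vec using (tabulate)
open import Data.Vec.Properties using (lookup∘tabulate; []=⇒lookup; lookup⇒[]=)
open import Data.Vec.Functional using (updateAt)
open import Data.Vec.Functional.Properties using (updateAt-updates; updateAt-minimal)
open import Data.Product using (Σ; ∃; ∃₂; _×_; _,_; proj₁; proj₂)
open import Data.Sum using (_⊎_; inj₁; inj₂)
open import Function using (_∘_; id; const)
open import Relation.Unary using (Pred; Decidable)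
open import Relation.Nullary using (¬_; Dec; yes; no; does; contradiction)
open import Relation.Nullary.Decidable using (dec-true; decidable-stable; T?; ¬?; _→-dec_; _⊎-dec_; _×-dec_)
open import Relation.Binary.PropositionalEquality using (_≡_; _≢_; refl; sym; trans; subst; subst₂; cong)

¬→⇒×¬ : ∀ {a b} {A : Set a} {B : Set b} → Dec A → ¬ (A → B) → A × ¬ B
¬→⇒×¬ A? ¬A→B = decidable-stable A? (λ ¬a → ¬A→B (λ a → contradiction a ¬a)) , ¬A→B ∘ const

¬∀²⟶∃²¬ : ∀ {n p} (P : Fin n → Fin n → Set p) → (∀ x y → Dec (P x y)) →
          ¬ (∀ x y → P x y) → ∃₂ λ x y → ¬ P x y
¬∀²⟶∃²¬ {n} P P? ¬∀P with ¬∀⟶∃¬ n _ (λ x → all? (P? x)) ¬∀P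
... | x , ¬∀Px with ¬∀⟶∃¬ n _ (P? x) ¬∀Px
...   | y , ¬Pxy = x , y , ¬Pxy

module _ {n p} {P : Pred (Fin n) p} (P? : Decidable P) where

  subsetOf : Subset n
  subsetOf = tabulate (does ∘ P?)

  ∈subsetOf⁺ : ∀ {x} → P x → x ∈ subsetOf
  ∈subsetOf⁺ {x} px = lookup⇒[]= x subsetOf (trans (lookup∘tabulate (does ∘ P?) x) (dec-true (P? x) px))

  ∈subsetOf⁻ : ∀ {x} → x ∈ subsetOf → P x
  ∈subsetOf⁻ {x} x∈ with P? x | trans (sym (lookup∘tabulate (does ∘ P?) x)) ([]=⇒lookup x∈)
  ... | yes px | _ = px
  ... | no _   | ()

module _ {n} (D : Digraph n) where

  oneWayEdge : ¬ Symmetric D → ∃₂ λ a b → Edge D a b × ¬ Edge D b a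
  oneWayEdge ¬sym with ¬∀²⟶∃²¬ _ (λ x y → T? _ →-dec T? _) ¬sym
  ... | a , b , ¬ab→ba = a , b , ¬→⇒×¬ (T? _) ¬ab→ba

  twoCycle : ¬ Antisymmetric D → ∃₂ λ c d → Edge D c d × Edge D d c
  twoCycle ¬antisym with ¬∀²⟶∃²¬ _ (λ x y → ¬? (x ≟ y) →-dec (T? _ →-dec ¬? (T? _))) ¬antisym
  ... | c , d , ¬cycle with ¬→⇒×¬ (T? _) (proj₂ (¬→⇒×¬ (¬? (c ≟ d)) ¬cycle))
  ...   | cd , ¬¬dc = c , d , cd , decidable-stable (T? _) ¬¬dc

  record Clique (m : ℕ) : Set where
    field
      vertex : Fin m → Fin n
      edge   : ∀ i j → i ≢ j → Edge D (vertex i) (vertex j)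

  open Clique

  _⇄_ : Fin n → Fin n → Set
  x ⇄ y = Edge D x y × Edge D y x

  pair : ∀ {c d} → c ⇄ d → Clique 2
  pair {c} {d} (cd , dc) = record { vertex = K ; edge = K-edge }
    where
    K : Fin 2 → Fin n
    K zero       = c
    K (suc zero) = d
    K-edge : ∀ i j → i ≢ j → Edge D (K i) (K j)
    K-edge zero       zero       i≢j = contradiction refl i≢j
    K-edge zero       (suc zero) _   = cd
    K-edge (suc zero) zero       _   = dc
    K-edge (suc zero) (suc zero) i≢j = contradiction refl i≢j

  cons : ∀ {m} (C : Clique m) {w} → (∀ i → vertex C i ⇄ w) → Clique (suc m)
  cons {m} C {w} C⇄w = record { vertex = K ; edge = K-edge }
    where
    K : Fin (suc m) → Fin n
    K zero    = w
    K (suc i) = vertex C i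
    K-edge : ∀ i j → i ≢ j → Edge D (K i) (K j)
    K-edge zero    zero    i≢j = contradiction refl i≢j
    K-edge zero    (suc j) _   = proj₂ (C⇄w j)
    K-edge (suc i) zero    _   = proj₁ (C⇄w i)
    K-edge (suc i) (suc j) i≢j = edge C i j (i≢j ∘ cong suc)

  mapClique : ∀ {m g} → IsEndo D g → Clique m → Clique m
  mapClique {g = g} endo C = record
    { vertex = g ∘ vertex C
    ; edge   = λ i j i≢j → endo _ _ (edge C i j i≢j)
    }

  module _ (irr : Irreflexive D) where

    Edge⇒≢ : ∀ {x y} → Edge D x y → x ≢ y
    Edge⇒≢ xy refl = irr _ xy

    cliqueTooLarge : ∀ {m} → n < m → ¬ Clique m
    cliqueTooLarge n<m C with pigeonhole n<m (vertex C)
    ... | i , j , i<j , Ki≡Kj = Edge⇒≢ (edge C i j (<⇒≢ i<j)) Ki≡Kj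

  IsHomOn : Subset n → (Fin n → Fin n) → Set
  IsHomOn A φ = ∀ {x y} → x ∈ A → y ∈ A → Edge D x y → Edge D (φ x) (φ y)

  module _ (hh : HomomorphismHomogeneous D) where

    extendHomOn : ∀ {A u} → u ∈ A → (φ : Fin n → Fin n) → IsHomOn A φ →
                  Σ (Fin n → Fin n) λ g → IsEndo D g × (∀ {x} → x ∈ A → g x ≡ φ x)
    extendHomOn {A} {u} u∈A φ hom
      with hh A ⊤ (u , u∈A) (φ u , ∈⊤) (λ (x , _) → φ x , ∈⊤) (λ (_ , x∈A) (_ , y∈A) → hom x∈A y∈A)
    ... | g , endo , g≗φ = g , endo , λ x∈A → g≗φ (_ , x∈A)

  module _ (irr : Irreflexive D) (hh : HomomorphismHomogeneous D) where

    endoSending : ∀ u t → Σ (Fin n → Fin n) λ g → IsEndo D g × g u ≡ t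
    endoSending u t with extendHomOn hh (x∈⁅x⁆ u) (const t) hom
      where
      hom : IsHomOn ⁅ u ⁆ (const t)
      hom x∈ y∈ xy = contradiction (trans (x∈⁅y⁆⇒x≡y u x∈) (sym (x∈⁅y⁆⇒x≡y u y∈))) (Edge⇒≢ irr xy)
    ... | g , endo , g≗t = g , endo , g≗t (x∈⁅x⁆ u)

    retractOnto : ∀ {m} (C : Clique m) j {u} → (∀ i → i ≢ j → u ≢ vertex C i) →
                  Σ (Fin n → Fin n) λ g → IsEndo D g × g u ≡ vertex C j ×
                                          (∀ i → i ≢ j → g (vertex C i) ≡ vertex C i)
    retractOnto C j {u} u∉C = retraction (extendHomOn hh (∈A (inj₁ refl)) φ hom)
      where
      K = vertex C
      Member : Pred (Fin n) _
      Member x = x ≡ u ⊎ ∃ λ i → i ≢ j × K i ≡ x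
      Member? : Decidable Member
      Member? x = (x ≟ u) ⊎-dec any? (λ i → ¬? (i ≟ j) ×-dec (K i ≟ x))
      ∈A : ∀ {x} → Member x → x ∈ subsetOf Member?
      ∈A = ∈subsetOf⁺ Member?
      φ : Fin n → Fin n
      φ = updateAt id u (const (K j))
      φu : φ u ≡ K j
      φu = updateAt-updates u id
      φK : ∀ {i} → i ≢ j → φ (K i) ≡ K i
      φK {i} i≢j = updateAt-minimal (K i) u id (λ Ki≡u → u∉C i i≢j (sym Ki≡u))
      hom : IsHomOn (subsetOf Member?) φ
      hom x∈ y∈ xy with ∈subsetOf⁻ Member? x∈ | ∈subsetOf⁻ Member? y∈
      ... | inj₁ refl | inj₁ refl = contradiction xy (irr u)
      ... | inj₁ refl | inj₂ (i , i≢j , refl) = subst₂ (Edge D) (sym φu) (sym (φK i≢j)) (edge C j i (i≢j ∘ sym))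
      ... | inj₂ (i , i≢j , refl) | inj₁ refl = subst₂ (Edge D) (sym (φK i≢j)) (sym φu) (edge C i j i≢j)
      ... | inj₂ (i , i≢j , refl) | inj₂ (i′ , i′≢j , refl) = subst₂ (Edge D) (sym (φK i≢j)) (sym (φK i′≢j)) xy
      retraction : (Σ (Fin n → Fin n) λ g → IsEndo D g × (∀ {x} → x ∈ subsetOf Member? → g x ≡ φ x)) →
                   Σ (Fin n → Fin n) λ g → IsEndo D g × g u ≡ K j × (∀ i → i ≢ j → g (K i) ≡ K i)
      retraction (g , endo , g≗φ) =
        g , endo , trans (g≗φ (∈A (inj₁ refl))) φu , λ i i≢j → trans (g≗φ (∈A (inj₂ (i , i≢j , refl)))) (φK i≢j)

    retractImage : ∀ {m} (C : Clique m) j {u} → (∀ i → i ≢ j → u ≢ vertex C i) →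
                   ∃ λ x → (∀ i → i ≢ j → vertex C i ⇄ x) ×
                           (Edge D u (vertex C j) → Edge D (vertex C j) x) ×
                           (Edge D (vertex C j) u → Edge D x (vertex C j))
    retractImage C j u∉C with retractOnto C j u∉C
    ... | g , endo , gu≡Kj , g≗id =
      g (K j) ,
      (λ i i≢j → subst (λ z → Edge D z (g (K j))) (g≗id i i≢j) (endo _ _ (edge C i j i≢j)) ,
                 subst (Edge D (g (K j))) (g≗id i i≢j) (endo _ _ (edge C j i (i≢j ∘ sym)))) ,
      (λ uKj → subst (λ z → Edge D z (g (K j))) gu≡Kj (endo _ _ uKj)) ,
      (λ Kju → subst (Edge D (g (K j))) gu≡Kj (endo _ _ Kju))
      where K = vertex C

    almostJoined : ∀ {a b m} → Edge D a b → ¬ Edge D b a → (C : Clique (suc m)) → vertex C zero ≡ b →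
                   ∃ λ v → (∀ i → Edge D (vertex C i) v) × (∀ i → i ≢ zero → Edge D v (vertex C i))
    almostJoined {a} ab ¬ba C K₀≡b with retractImage C zero a∉C
      where
      a∉C : ∀ i → i ≢ zero → a ≢ vertex C i
      a∉C i i≢0 refl = ¬ba (subst (λ z → Edge D z a) K₀≡b (edge C zero i (i≢0 ∘ sym)))
    ... | v , K⇄v , aK₀→K₀v , _ = v , Kv , λ i i≢0 → proj₂ (K⇄v i i≢0)
      where
      Kv : ∀ i → Edge D (vertex C i) v
      Kv zero    = aK₀→K₀v (subst (Edge D a) (sym K₀≡b) ab)
      Kv (suc i) = proj₁ (K⇄v (suc i) λ ())

    joined : ∀ {m} (C : Clique (2 + m)) {v} →
             (∀ i → Edge D (vertex C i) v) → (∀ i → i ≢ zero → Edge D v (vertex C i)) →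
             ∃ λ w → ∀ i → vertex C i ⇄ w
    joined C {v} Kv vK with retractImage C (suc zero) (λ i _ v≡Ki → Edge⇒≢ irr (Kv i) (sym v≡Ki))
    ... | w , K⇄w , vK₁→K₁w , K₁v→wK₁ = w , K⇄w′
      where
      K⇄w′ : ∀ i → vertex C i ⇄ w
      K⇄w′ i with i ≟ suc zero
      ... | yes refl = vK₁→K₁w (vK _ λ ()) , K₁v→wK₁ (Kv _)
      ... | no i≢1   = K⇄w i i≢1

    grow : ∀ {a b m} → Edge D a b → ¬ Edge D b a → Clique (2 + m) → Clique (3 + m)
    grow {b = b} ab ¬ba C with endoSending (vertex C zero) b
    ... | h , h-endo , hK₀≡b with almostJoined ab ¬ba (mapClique h-endo C) hK₀≡b
    ...   | v , Kv , vK with joined (mapClique h-endo C) Kv vK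
    ...     | w , K⇄w = cons (mapClique h-endo C) K⇄w

    cliquesOfEverySize : ∀ {a b c d} → Edge D a b → ¬ Edge D b a → c ⇄ d → ∀ m → Clique (2 + m)
    cliquesOfEverySize ab ¬ba c⇄d zero    = pair c⇄d
    cliquesOfEverySize ab ¬ba c⇄d (suc m) = grow ab ¬ba (cliquesOfEverySize ab ¬ba c⇄d m)

proposition3p3 : ∀ (n : ℕ) (D : Digraph n) →
    ¬ (Irreflexive D × Improper D × HomomorphismHomogeneous D)
proposition3p3 n D (irr , (¬sym , ¬antisym) , hh) with oneWayEdge D ¬sym | twoCycle D ¬antisym
... | _ , _ , ab , ¬ba | _ , _ , c⇄d =
  cliqueTooLarge D irr (m<n+m n z<s) (cliquesOfEverySize D irr hh ab ¬ba c⇄d n)
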